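{- Let $S$ be an external $k$-star and let $b\ge 1$ be its number of $k$-boundary edges. Then $S$ has exactly $b-1$ positive ears. Moreover, the $k$-boundary edges and positive ears of $S$ form an alternating path in the $k$-star.
   Context: Let $n\ge 2k+3$. $V_n$ is the vertex set of a convex $n$-gon on the unit circle labelled counterclockwise by $\mathbb{Z}_n$; $u\prec v\prec w$ denotes counterclockwise order ($\preccurlyeq$ allows equality). The length of edge $[u,v]$ is $\min(|\{w: u\preccurlyeq w\prec v\}|,|\{w: v\preccurlyeq w\prec u\}|)$; an edge of length $k$ is a $k$-boundary edge. A $k$-star is a set of edges $\{[s_j,s_{j+k}]: j\in\mathbb{Z}_{2k+1}\}$ with $s_0\prec\dots\prec s_{2k}\prec s_0$; it is external if it contains at least one $k$-boundary edge. If $V$ is the vertex set of $S$, then $S$ lies on the positive side of the oriented edge from $u$ to $v$ if $|\{w\in V: u\preccurlyeq w\preccurlyeq v\}|<|\{w\in V: v\preccurlyeq w\preccurlyeq u\}|$. An edge $[u,v]$ of $S$ such that $S$ lies on the positive side of the oriented edge from $u$ to $v$ is a positive ear of $S$ if $|\{w\in V_n: v\preccurlyeq w\prec u\}|=k+1$. -}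

module Defs where

open import Data.Nat using (ℕ; zero; suc; _+_; _*_; _∸_; _≤_; _<_; _⊓_; _≤?_; _<?_; _≟_)
open import Data.Nat.DivMod using (_%_)
open import Data.List using (List; upTo; filter; length)
open import Data.Product using (_×_; Σ; ∃; _,_)
open import Data.Sum using (_⊎_)
open import Relation.Nullary using (Dec; yes; no)
open import Relation.Nullary.Decidable using (_×-dec_; _⊎-dec_)
open import Relation.Binary.PropositionalEquality using (_≡_)
open import Relation.Unary using (Pred; Decidable)
open import Level using (0ℓ)

count : {P : Pred ℕ 0ℓ} → Decidable P → List ℕ → ℕ
count P? xs = length (filter P? xs)

-- Vertices of the n-gon: naturals u < n (i.e. ℤ_n), labelled counterclockwise.
-- ccwDist n u v = |{ w : u ≼ w ≺ v }| = number of steps counterclockwise from u to v.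
ccwDist : ℕ → ℕ → ℕ → ℕ
ccwDist n u v = (v + n ∸ u) % suc (n ∸ 1)   -- n ≥ 1 in all uses; suc (n ∸ 1) = n

between : ℕ → ℕ → ℕ → ℕ → Set
between n u w v = ccwDist n u w ≤ ccwDist n u v

between? : ∀ n u w v → Dec (between n u w v)
between? n u w v = ccwDist n u w ≤? ccwDist n u v

edgeLength : ℕ → ℕ → ℕ → ℕ
edgeLength n u v = ccwDist n u v ⊓ ccwDist n v u

-- A k-star in the n-gon: vertices s 0 ≺ s 1 ≺ … ≺ s (2k) ≺ s 0.
-- Since the labelling of a k-star may be rotated freely without changing
-- its edge set, we take s 0 to be the smallest label, so the cyclic order
-- becomes  s 0 < s 1 < … < s (2k) < n.

IsStar : (k n : ℕ) → (ℕ → ℕ) → Set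
IsStar k n s = (∀ i → suc i < suc (2 * k) → s i < s (suc i)) × s (2 * k) < n

idx : ℕ → ℕ → ℕ
idx k j = j % suc (2 * k)

vtx : ℕ → (ℕ → ℕ) → ℕ → ℕ
vtx k s j = s (idx k j)

eA eB : ℕ → (ℕ → ℕ) → ℕ → ℕ
eA k s j = vtx k s j
eB k s j = vtx k s (j + k)

IsBoundary : (k n : ℕ) → (ℕ → ℕ) → ℕ → Set
IsBoundary k n s j = edgeLength n (eA k s j) (eB k s j) ≡ k

isBoundary? : ∀ k n s j → Dec (IsBoundary k n s j)
isBoundary? k n s j = edgeLength n (eA k s j) (eB k s j) ≟ k

countBetween : (k n : ℕ) → (ℕ → ℕ) → ℕ → ℕ → ℕ
countBetween k n s u v = count (λ i → between? n u (s i) v) (upTo (suc (2 * k)))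

PositiveSide : (k n : ℕ) → (ℕ → ℕ) → ℕ → ℕ → Set
PositiveSide k n s u v = countBetween k n s u v < countBetween k n s v u

positiveSide? : ∀ k n s u v → Dec (PositiveSide k n s u v)
positiveSide? k n s u v = countBetween k n s u v <? countBetween k n s v u

PosEarOriented : (k n : ℕ) → (ℕ → ℕ) → ℕ → ℕ → Set
PosEarOriented k n s u v = PositiveSide k n s u v × ccwDist n v u ≡ suc k

posEarOriented? : ∀ k n s u v → Dec (PosEarOriented k n s u v)
posEarOriented? k n s u v = positiveSide? k n s u v ×-dec (ccwDist n v u ≟ suc k)

IsPositiveEar : (k n : ℕ) → (ℕ → ℕ) → ℕ → Set
IsPositiveEar k n s j =
  PosEarOriented k n s (eA k s j) (eB k s j) ⊎ PosEarOriented k n s (eB k s j) (eA k s j)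

isPositiveEar? : ∀ k n s j → Dec (IsPositiveEar k n s j)
isPositiveEar? k n s j =
  posEarOriented? k n s (eA k s j) (eB k s j) ⊎-dec posEarOriented? k n s (eB k s j) (eA k s j)

IsExternal : (k n : ℕ) → (ℕ → ℕ) → Set
IsExternal k n s = Σ ℕ λ j → j < suc (2 * k) × IsBoundary k n s j

numBoundary numPosEars : (k n : ℕ) → (ℕ → ℕ) → ℕ
numBoundary k n s = count (isBoundary? k n s) (upTo (suc (2 * k)))
numPosEars  k n s = count (isPositiveEar? k n s) (upTo (suc (2 * k)))

-- In the star graph (a cycle), edge j and edge j+k share the vertex s_{j+k};
-- so a walk of L edges starting at edge j₀ is  idx (j₀ + i*k), i < L.
pathEdge : ℕ → ℕ → ℕ → ℕ
pathEdge k j₀ i = idx k (j₀ + i * k)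

AlternatingPath : (k n : ℕ) → (ℕ → ℕ) → ℕ → Set
AlternatingPath k n s b =
  let L = 2 * b ∸ 1 in
  Σ ℕ λ j₀ → j₀ < suc (2 * k) ×
    (∀ i i′ → i < L → i′ < L → pathEdge k j₀ i ≡ pathEdge k j₀ i′ → i ≡ i′) ×
    (∀ i → i < L → (i % 2 ≡ 0 → IsBoundary k n s (pathEdge k j₀ i))
                 × (i % 2 ≡ 1 → IsPositiveEar k n s (pathEdge k j₀ i))) ×
    (∀ j → j < suc (2 * k) → IsBoundary k n s j ⊎ IsPositiveEar k n s j →
       Σ ℕ λ i → i < L × j ≡ pathEdge k j₀ i)

-- Lift the star vertices to the strictly increasing sequence
-- S : ℕ → ℕ with S (r + q·m) = s r + q·n, where m = 2k + 1, and call the x-th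
-- gap a unit if S (x + 1) = S x + 1.  Counterclockwise distances between star
-- vertices are differences of S, so the edge j = [s_j, s_{j+k}] is a k-boundary
-- edge iff its k forward gaps are units, and a positive ear iff the k + 1 gaps
-- leading from s_{j+k} back to s_j are units (S always lies on the positive side
-- of s_j → s_{j+k}).  As n > m, the unit gaps never fill a whole period, so a
-- boundary edge lies in a maximal run of k + R unit gaps (R ≤ k) delimited by
-- non-unit gaps.  Its windows of length k and k + 1 are the R + 1 boundary edges
-- and the R ears, and stepping k edges at a time (one vertex backwards modulo m)
-- visits them alternately.
module Submission where

open import Defs
open import Data.Nat using (ℕ; zero; suc; _+_; _*_; _∸_; _≤_; _<_; _⊓_; z≤n; s≤s; NonZero; _≟_; _≤?_; _<?_)
open import Data.Nat.Properties
open import Data.Nat.DivMod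
open import Data.Nat.Divisibility using (divides-refl)
open import Data.Nat.Tactic.RingSolver using (solve-∀)
open import Data.List using (_∷_; upTo; applyUpTo)
open import Data.Product using (_×_; _,_; proj₁; proj₂; Σ; ∃-syntax)
open import Data.Sum using (_⊎_; inj₁; inj₂)
open import Function using (_∘_; id)
open import Function.Bundles using (_⇔_; mk⇔; module Equivalence)
open import Relation.Nullary using (¬_; Dec; yes; no; contradiction)
open import Relation.Unary using (Pred; Decidable)
open import Relation.Binary.PropositionalEquality
open import Level using (0ℓ)

import Function.Properties.Equivalence as ⇔
import Relation.Binary.Reasoning.Setoid as SetoidReasoning

open Equivalence using (to; from)

module ⇔-Reasoning where
  open SetoidReasoning (⇔.⇔-setoid 0ℓ) public using (begin_; step-≈-⟩; step-≈-⟨; _∎)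

-- 2 * k does not reduce to k + k
double : ∀ k → 2 * k ≡ k + k
double k = cong (k +_) (+-identityʳ k)

parity : ∀ i → ∃[ t ] (i ≡ t + t ⊎ i ≡ suc (t + t))
parity zero = 0 , inj₁ refl
parity (suc i) with parity i
... | t , inj₁ refl = t , inj₂ refl
... | t , inj₂ refl = suc t , inj₁ (cong suc (sym (+-suc t t)))

even%2 : ∀ t → (t + t) % 2 ≡ 0
even%2 t = trans (cong (_% 2) (twice t)) ([m+kn]%n≡m%n 0 t 2)
  where
  twice : ∀ t → t + t ≡ 0 + t * 2
  twice = solve-∀

odd%2 : ∀ t → suc (t + t) % 2 ≡ 1
odd%2 t = trans (cong (_% 2) (twice t)) ([m+kn]%n≡m%n 1 t 2)
  where
  twice : ∀ t → suc (t + t) ≡ 1 + t * 2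
  twice = solve-∀

half-≤ : ∀ {t u} → t + t ≤ u + u → t ≤ u
half-≤ le = ≮⇒≥ λ u<t → <⇒≱ (+-mono-< u<t u<t) le

half-< : ∀ {t u} → t + t < u + u → t < u
half-< lt = ≰⇒> λ u≤t → <⇒≱ lt (+-mono-≤ u≤t u≤t)

shift-≤ : ∀ a b c → a + c ≤ c + b ⇔ a ≤ b
shift-≤ a b c = mk⇔ (λ le → +-cancelʳ-≤ c a b (subst (a + c ≤_) (+-comm c b) le))
                       (λ le → subst (a + c ≤_) (+-comm b c) (+-monoˡ-≤ c le))

∸-≤⇔ : ∀ {a b c} → c ≤ a → c ≤ b → a ∸ c ≤ b ∸ c ⇔ a ≤ b
∸-≤⇔ {a} {b} {c} c≤a c≤b = mk⇔
  (λ le → subst₂ _≤_ (m∸n+n≡m c≤a) (m∸n+n≡m c≤b) (+-monoˡ-≤ c le))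
  (∸-monoˡ-≤ c)

mod-difference : ∀ n .{{_ : NonZero n}} u v a b w → u < n → w < n →
                 v + a * n ≡ u + b * n + w → (v + n ∸ u) % n ≡ w
mod-difference n u v a b w u<n w<n eq = begin
  T % n                  ≡⟨ [m+kn]%n≡m%n T a n ⟨
  (T + a * n) % n        ≡⟨ cong (_% n) (+-cancelʳ-≡ u _ _ shifted) ⟩
  (w + suc b * n) % n    ≡⟨ [m+kn]%n≡m%n w (suc b) n ⟩
  w % n                  ≡⟨ m<n⇒m%n≡m w<n ⟩
  w                      ∎
  where
  open ≡-Reasoning
  T : ℕ
  T = v + n ∸ u
  shifted : T + a * n + u ≡ w + suc b * n + u
  shifted = begin
    T + a * n + u          ≡⟨ swap T (a * n) u ⟩
    T + u + a * n          ≡⟨ cong (_+ a * n) (m∸n+n≡m (≤-trans (<⇒≤ u<n) (m≤n+m n v))) ⟩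
    v + n + a * n          ≡⟨ swap v n (a * n) ⟩
    v + a * n + n          ≡⟨ cong (_+ n) eq ⟩
    u + b * n + w + n      ≡⟨ regroup u b n w ⟩
    w + suc b * n + u      ∎
    where
    swap : ∀ x y z → x + y + z ≡ x + z + y
    swap = solve-∀
    regroup : ∀ u b n w → u + b * n + w + n ≡ w + suc b * n + u
    regroup = solve-∀

⊓≡⇔ : ∀ {a b k} → k ≤ a → k < b → a ⊓ b ≡ k ⇔ a ≡ k
⊓≡⇔ {a} {b} {k} k≤a k<b =
  mk⇔ left (λ a≡k → trans (m≤n⇒m⊓n≡m (subst (_≤ b) (sym a≡k) (<⇒≤ k<b))) a≡k)
  where
  left : a ⊓ b ≡ k → a ≡ k
  left min≡k with ≤-total a b
  ... | inj₁ a≤b = trans (sym (m≤n⇒m⊓n≡m a≤b)) min≡k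
  ... | inj₂ b≤a = contradiction (trans (sym (m≥n⇒m⊓n≡n b≤a)) min≡k) (>⇒≢ k<b)

≡⇒⇔ : {A B : Set} → A ≡ B → A ⇔ B
≡⇒⇔ refl = mk⇔ id id

indicator : {A : Set} → Dec A → ℕ
indicator (yes _) = 1
indicator (no _)  = 0

indicator-cong : {A B : Set} → A ⇔ B → (a : Dec A) (b : Dec B) → indicator a ≡ indicator b
indicator-cong A⇔B (yes _) (yes _) = refl
indicator-cong A⇔B (yes a) (no ¬b) = contradiction (to A⇔B a) ¬b
indicator-cong A⇔B (no ¬a) (yes b) = contradiction (from A⇔B b) ¬a
indicator-cong A⇔B (no _)  (no _)  = refl

module Counting {P : Pred ℕ 0ℓ} (P? : Decidable P) where

  countIn : ℕ → ℕ → ℕ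
  countIn a zero    = 0
  countIn a (suc l) = indicator (P? a) + countIn (suc a) l

  count-∷ : ∀ x xs → count P? (x ∷ xs) ≡ indicator (P? x) + count P? xs
  count-∷ x xs with P? x
  ... | yes _ = refl
  ... | no _  = refl

  count-upTo : ∀ l → count P? (upTo l) ≡ countIn 0 l
  count-upTo l = count-applyUpTo l id 0 (λ _ → refl)
    where
    count-applyUpTo : ∀ l f a → (∀ i → f i ≡ a + i) → count P? (applyUpTo f l) ≡ countIn a l
    count-applyUpTo zero    f a f≗ = refl
    count-applyUpTo (suc l) f a f≗ = trans (count-∷ (f 0) (applyUpTo (f ∘ suc) l))
      (cong₂ _+_ (cong (indicator ∘ P?) (trans (f≗ 0) (+-identityʳ a)))
                 (count-applyUpTo l (f ∘ suc) (suc a) (λ i → trans (f≗ (suc i)) (+-suc a i))))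

  countIn-++ : ∀ a x y → countIn a (x + y) ≡ countIn a x + countIn (a + x) y
  countIn-++ a zero    y = cong (λ b → countIn b y) (sym (+-identityʳ a))
  countIn-++ a (suc x) y = begin
    indicator (P? a) + countIn (suc a) (x + y)
      ≡⟨ cong (indicator (P? a) +_) (countIn-++ (suc a) x y) ⟩
    indicator (P? a) + (countIn (suc a) x + countIn (suc a + x) y)
      ≡⟨ sym (+-assoc (indicator (P? a)) _ _) ⟩
    indicator (P? a) + countIn (suc a) x + countIn (suc a + x) y
      ≡⟨ cong (λ b → indicator (P? a) + countIn (suc a) x + countIn b y) (sym (+-suc a x)) ⟩
    indicator (P? a) + countIn (suc a) x + countIn (a + suc x) y ∎
    where open ≡-Reasoning

  countIn-all : ∀ a l → (∀ d → d < l → P (a + d)) → countIn a l ≡ l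
  countIn-all a zero    all = refl
  countIn-all a (suc l) all with P? a
  ... | yes _ = cong suc (countIn-all (suc a) l
                  (λ d d<l → subst P (+-suc a d) (all (suc d) (s≤s d<l))))
  ... | no ¬p = contradiction (subst P (+-identityʳ a) (all 0 (s≤s z≤n))) ¬p

  countIn-none : ∀ a l → (∀ d → d < l → ¬ P (a + d)) → countIn a l ≡ 0
  countIn-none a zero    none = refl
  countIn-none a (suc l) none with P? a
  ... | no _  = countIn-none (suc a) l
                  (λ d d<l p → none (suc d) (s≤s d<l) (subst P (sym (+-suc a d)) p))
  ... | yes p = contradiction (subst P (sym (+-identityʳ a)) p) (none 0 (s≤s z≤n))

  countIn-rotate : ∀ l → (∀ i → P (i + l) ⇔ P i) → ∀ a → countIn 0 l ≡ countIn a l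
  countIn-rotate l periodic zero    = refl
  countIn-rotate l periodic (suc a) = trans (countIn-rotate l periodic a) step
    where
    open ≡-Reasoning
    step : countIn a l ≡ countIn (suc a) l
    step = +-cancelʳ-≡ (indicator (P? a)) _ _ (begin
      countIn a l + indicator (P? a)
        ≡⟨ cong (countIn a l +_) (indicator-cong (periodic a) (P? (a + l)) (P? a)) ⟨
      countIn a l + indicator (P? (a + l))
        ≡⟨ cong (countIn a l +_) (+-identityʳ _) ⟨
      countIn a l + countIn (a + l) 1
        ≡⟨ countIn-++ a l 1 ⟨
      countIn a (l + 1)
        ≡⟨ cong (countIn a) (+-comm l 1) ⟩
      indicator (P? a) + countIn (suc a) l
        ≡⟨ +-comm (indicator (P? a)) _ ⟩
      countIn (suc a) l + indicator (P? a) ∎)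

  countIn-interval : ∀ a N lo len → lo + len ≤ N →
    (∀ y → y < N → P (a + y) ⇔ (lo ≤ y × y < lo + len)) → countIn a N ≡ len
  countIn-interval a N lo len fits window with m≤n⇒∃[o]m+o≡n fits
  ... | rest , refl = begin
    countIn a (lo + len + rest)
      ≡⟨ countIn-++ a (lo + len) rest ⟩
    countIn a (lo + len) + countIn (a + (lo + len)) rest
      ≡⟨ cong (_+ countIn (a + (lo + len)) rest) (countIn-++ a lo len) ⟩
    countIn a lo + countIn (a + lo) len + countIn (a + (lo + len)) rest
      ≡⟨ cong₂ (λ x z → x + countIn (a + lo) len + z) before after ⟩
    countIn (a + lo) len + 0
      ≡⟨ cong (_+ 0) inside ⟩
    len + 0
      ≡⟨ +-identityʳ len ⟩
    len ∎
    where
    open ≡-Reasoning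
    before : countIn a lo ≡ 0
    before = countIn-none a lo λ d d<lo p →
      <⇒≱ d<lo (proj₁ (to (window d (<-≤-trans d<lo (≤-trans (m≤m+n lo len) (m≤m+n _ rest)))) p))
    inside : countIn (a + lo) len ≡ len
    inside = countIn-all (a + lo) len λ d d<len → subst P (sym (+-assoc a lo d))
      (from (window (lo + d) (<-≤-trans (+-monoʳ-< lo d<len) (m≤m+n _ rest)))
        (m≤m+n lo d , +-monoʳ-< lo d<len))
    after : countIn (a + (lo + len)) rest ≡ 0
    after = countIn-none (a + (lo + len)) rest λ d d<rest p →
      <⇒≱ (proj₂ (to (window (lo + len + d) (+-monoʳ-< (lo + len) d<rest))
                      (subst P (+-assoc a (lo + len) d) p)))
          (m≤m+n (lo + len) d)

open Counting using (countIn; count-upTo; countIn-rotate; countIn-interval)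

countIn-cong : ∀ {P Q : Pred ℕ 0ℓ} (P? : Decidable P) (Q? : Decidable Q) a l →
  (∀ d → d < l → P (a + d) ⇔ Q (a + d)) → countIn P? a l ≡ countIn Q? a l
countIn-cong P? Q? a zero    agree = refl
countIn-cong {P} {Q} P? Q? a (suc l) agree = cong₂ _+_
  (indicator-cong (subst (λ x → P x ⇔ Q x) (+-identityʳ a) (agree 0 (s≤s z≤n))) (P? a) (Q? a))
  (countIn-cong P? Q? (suc a) l λ d d<l →
    subst (λ x → P x ⇔ Q x) (+-suc a d) (agree (suc d) (s≤s d<l)))

module Cyclic (N : ℕ) .{{_ : NonZero N}} where

  %-absorbˡ : ∀ x y → (x % N + y) % N ≡ (x + y) % N
  %-absorbˡ x y = begin
    (x % N + y) % N           ≡⟨ %-distribˡ-+ (x % N) y N ⟩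
    (x % N % N + y % N) % N   ≡⟨ cong (λ z → (z + y % N) % N) (m%n%n≡m%n x N) ⟩
    (x % N + y % N) % N       ≡⟨ %-distribˡ-+ x y N ⟨
    (x + y) % N               ∎
    where open ≡-Reasoning

  %-absorbʳ : ∀ x y → (x + y % N) % N ≡ (x + y) % N
  %-absorbʳ x y = begin
    (x + y % N) % N   ≡⟨ cong (_% N) (+-comm x (y % N)) ⟩
    (y % N + x) % N   ≡⟨ %-absorbˡ y x ⟩
    (y + x) % N       ≡⟨ cong (_% N) (+-comm y x) ⟩
    (x + y) % N       ∎
    where open ≡-Reasoning

  offset : ℕ → ℕ → ℕ
  offset a j = (j + (N ∸ a % N)) % N

  undo : ∀ a j → a + (j + (N ∸ a % N)) ≡ j + suc (a / N) * N
  undo a j = begin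
    a + (j + c)                      ≡⟨ cong (_+ (j + c)) (m≡m%n+[m/n]*n a N) ⟩
    (a % N + a / N * N) + (j + c)    ≡⟨ regroup (a % N) (a / N * N) j c ⟩
    j + (a % N + c) + a / N * N      ≡⟨ cong (λ z → j + z + a / N * N) (m+[n∸m]≡n (m%n≤n a N)) ⟩
    j + N + a / N * N                ≡⟨ +-assoc j N _ ⟩
    j + suc (a / N) * N              ∎
    where
    open ≡-Reasoning
    c : ℕ
    c = N ∸ a % N
    regroup : ∀ r q j c → (r + q) + (j + c) ≡ j + (r + c) + q
    regroup = solve-∀

  offset<N : ∀ a j → offset a j < N
  offset<N a j = m%n<n (j + (N ∸ a % N)) N

  offset-reaches : ∀ a j → j < N → (a + offset a j) % N ≡ j
  offset-reaches a j j<N = begin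
    (a + (j + (N ∸ a % N)) % N) % N   ≡⟨ %-absorbʳ a _ ⟩
    (a + (j + (N ∸ a % N))) % N       ≡⟨ cong (_% N) (undo a j) ⟩
    (j + suc (a / N) * N) % N         ≡⟨ [m+kn]%n≡m%n j (suc (a / N)) N ⟩
    j % N                             ≡⟨ m<n⇒m%n≡m j<N ⟩
    j                                 ∎
    where open ≡-Reasoning

  offset-inverse : ∀ a y → y < N → offset a ((a + y) % N) ≡ y
  offset-inverse a y y<N = begin
    ((a + y) % N + (N ∸ a % N)) % N   ≡⟨ %-absorbˡ (a + y) _ ⟩
    (a + y + (N ∸ a % N)) % N         ≡⟨ cong (_% N) (+-assoc a y _) ⟩
    (a + (y + (N ∸ a % N))) % N       ≡⟨ cong (_% N) (undo a y) ⟩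
    (y + suc (a / N) * N) % N         ≡⟨ [m+kn]%n≡m%n y (suc (a / N)) N ⟩
    y % N                             ≡⟨ m<n⇒m%n≡m y<N ⟩
    y                                 ∎
    where open ≡-Reasoning

  offset-unique : ∀ a y y′ → y < N → y′ < N → (a + y) % N ≡ (a + y′) % N → y ≡ y′
  offset-unique a y y′ y<N y′<N eq =
    trans (sym (offset-inverse a y y<N)) (trans (cong (offset a) eq) (offset-inverse a y′ y′<N))

  residue⇔ : {P : Pred ℕ 0ℓ} → (∀ x → P (x + N) ⇔ P x) → ∀ x → P (x % N) ⇔ P x
  residue⇔ {P} periodic x = ⇔.trans (⇔.sym (shifts (x % N) (x / N)))
                                    (≡⇒⇔ (cong P (sym (m≡m%n+[m/n]*n x N))))
    where
    shifts : ∀ r q → P (r + q * N) ⇔ P r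
    shifts r zero    = ≡⇒⇔ (cong P (+-identityʳ r))
    shifts r (suc q) = ⇔.trans (≡⇒⇔ (cong P (regroup r q N)))
                              (⇔.trans (periodic (r + q * N)) (shifts r q))
      where
      regroup : ∀ r q N → r + (N + q * N) ≡ r + q * N + N
      regroup = solve-∀

-- Runs of a decidable predicate U on ℕ.  In the application U x says that the
-- x-th gap between consecutive star vertices has length one.
module Runs {U : Pred ℕ 0ℓ} (U? : Decidable U) where

  Run : ℕ → ℕ → Set
  Run x L = ∀ d → d < L → U (x + d)

  run-sub : ∀ {x L} z W → z + W ≤ L → Run x L → Run (x + z) W
  run-sub {x} z W fits run d d<W =
    subst U (sym (+-assoc x z d)) (run (z + d) (<-≤-trans (+-monoʳ-< z d<W) fits))

  run-covers : ∀ {x z W} q → Run (x + z) W → z ≤ q → q < z + W → U (x + q)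
  run-covers {x} {z} {W} q run z≤q q<z+W with m≤n⇒∃[o]m+o≡n z≤q
  ... | e , refl = subst U (+-assoc x z e) (run e (+-cancelˡ-< z e W q<z+W))

  run-++ : ∀ {x L L′} → Run x L → Run (x + L) L′ → Run x (L + L′)
  run-++ {x} {L} {L′} run run′ d d<L+L′ with d <? L
  ... | yes d<L = run d d<L
  ... | no  d≮L = run-covers {x} {L} {L′} d run′ (≮⇒≥ d≮L) d<L+L′

  run-single : ∀ {x} → U x → Run x 1
  run-single {x} u zero    _          = subst U (sym (+-identityʳ x)) u
  run-single     u (suc d) (s≤s ())

  run-snoc : ∀ {x L} → Run x L → U (x + L) → Run x (suc L)
  run-snoc {x} {L} run u = subst (Run x) (+-comm L 1) (run-++ run (run-single u))

  run-cons : ∀ {x L} → U x → Run (suc x) L → Run x (suc L)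
  run-cons {x} u run zero    _         = subst U (sym (+-identityʳ x)) u
  run-cons {x} u run (suc d) (s≤s d<L) = subst U (sym (+-suc x d)) (run d d<L)

  firstFailure : ∀ x L → ¬ Run x L → ∃[ t ] t < L × Run x t × ¬ U (x + t)
  firstFailure x zero    ¬run = contradiction (λ _ ()) ¬run
  firstFailure x (suc L) ¬run with U? x
  ... | no  ¬u = 0 , s≤s z≤n , (λ _ ()) , subst (¬_ ∘ U) (sym (+-identityʳ x)) ¬u
  ... | yes u with firstFailure (suc x) L (¬run ∘ run-cons u)
  ...   | t , t<L , run , fails = suc t , s≤s t<L , run-cons u run , subst (¬_ ∘ U) (sym (+-suc x t)) fails

  lastFailure : ∀ d x → ¬ U x → ∃[ u ] ∃[ L ] u + L ≡ d × ¬ U (x + u) × Run (suc (x + u)) L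
  lastFailure zero    x fails = 0 , 0 , refl , subst (¬_ ∘ U) (sym (+-identityʳ x)) fails , λ _ ()
  lastFailure (suc d) x fails with lastFailure d x fails
  ... | u , L , refl , fails-u , run with U? (x + suc (u + L))
  ...   | yes good = u , suc L , +-suc u L , fails-u , run-snoc run (subst U next good)
    where
    next : x + suc (u + L) ≡ suc (x + u) + L
    next = trans (+-suc x (u + L)) (cong suc (sym (+-assoc x u L)))
  ...   | no  bad  = suc (u + L) , 0 , +-identityʳ _ , bad , λ _ ()

  module Periodic (k : ℕ) (periodic : ∀ x → U (x + suc (2 * k)) ⇔ U x)
                  (noFullRun : ∀ x → ¬ Run x (suc (2 * k))) where

    m : ℕ
    m = suc (2 * k)

    run-shift : ∀ x L → Run (x + m) L ⇔ Run x L
    run-shift x L = mk⇔ (λ run d d<L → to   (shifted d) (run d d<L))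
                        (λ run d d<L → from (shifted d) (run d d<L))
      where
      swap : ∀ x m d → x + m + d ≡ x + d + m
      swap = solve-∀
      shifted : ∀ d → U (x + m + d) ⇔ U (x + d)
      shifted d = ⇔.trans (≡⇒⇔ (cong U (swap x m d))) (periodic (x + d))

    fails-shift : ∀ x → ¬ U x → ¬ U (x + m)
    fails-shift x fails = fails ∘ to (periodic x)

    -- A maximal run of length k + R: it is followed by a failure, and preceded by
    -- one, since start + 2k is the position before start up to the period.
    record MaxRun : Set where
      field
        start R      : ℕ
        run          : Run start (k + R)
        fails-after  : ¬ U (start + (k + R))
        fails-before : ¬ U (start + 2 * k)

    -- Scan forward from j to the first
    -- failure j + t (t ≥ k, as [j, j + k) is a run), then forward from j + t to the
    -- last failure before j + m; the run after it joins the copy of [j, j + t)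
    -- shifted by m, and ends at the copy j + t + m of the first failure.
    maxRun : ∀ j → Run j k → MaxRun
    maxRun j runₖ with firstFailure j m (noFullRun j)
    ... | t , t<m , runₜ , fails-t with m≤n⇒∃[o]m+o≡n (≮⇒≥ λ t<k → fails-t (runₖ t t<k))
    ... | r , refl with m≤n⇒∃[o]m+o≡n (≤-pred t<m)
    ... | o , t+o≡2k with lastFailure o (j + t) fails-t
    ... | u , L , refl , fails-u , runₗ = record
      { start        = a
      ; R            = L + r
      ; run          = subst (Run a) (swap L k r) whole
      ; fails-after  = subst (¬_ ∘ U) after (fails-shift (j + t) fails-t)
      ; fails-before = subst (¬_ ∘ U) (before (j + t + u) k) (fails-shift (j + t + u) fails-u)
      }
      where
      a : ℕ
      a = suc (j + t + u)
      swap : ∀ L k r → L + (k + r) ≡ k + (L + r)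
      swap = solve-∀
      before : ∀ x k → x + suc (2 * k) ≡ suc x + 2 * k
      before = solve-∀
      reach : a + L ≡ j + m
      reach = begin
        suc (j + t + u) + L      ≡⟨ cong suc (trans (+-assoc (j + t) u L) (+-assoc j t (u + L))) ⟩
        suc (j + (t + (u + L)))  ≡⟨ cong (λ z → suc (j + z)) t+o≡2k ⟩
        suc (j + 2 * k)          ≡⟨ +-suc j (2 * k) ⟨
        j + m                    ∎
        where open ≡-Reasoning
      after : j + t + m ≡ a + (k + (L + r))
      after = begin
        j + t + m                ≡⟨ +-assoc j t m ⟩
        j + (t + m)              ≡⟨ cong (j +_) (+-comm t m) ⟩
        j + (m + t)              ≡⟨ +-assoc j m t ⟨
        j + m + t                ≡⟨ cong (_+ t) reach ⟨
        a + L + t                ≡⟨ +-assoc a L t ⟩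
        a + (L + t)              ≡⟨ cong (a +_) (swap L k r) ⟩
        a + (k + (L + r))        ∎
        where open ≡-Reasoning
      whole : Run a (L + t)
      whole = run-++ runₗ (subst (λ x → Run x t) (sym reach) (from (run-shift j t) runₜ))

    module Around (mr : MaxRun) where
      open MaxRun mr

      -- the maximal run does not reach the failure at start + 2k
      R≤k : R ≤ k
      R≤k = ≮⇒≥ λ k<R → fails-before (run (2 * k) (subst (_< k + R) (sym (double k)) (+-monoʳ-< k k<R)))

      -- A window of length W ≥ k starting at offset z ≤ 2k is a run iff it lies in the
      -- maximal run: otherwise it contains one of the failures at offsets k + R and 2k.
      window : ∀ z W → k ≤ W → z ≤ 2 * k → Run (start + z) W ⇔ z + W ≤ k + R
      window z W k≤W z≤2k = mk⇔ inside (λ fits → run-sub z W fits run)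
        where
        inside : Run (start + z) W → z + W ≤ k + R
        inside runW with z + W ≤? k + R
        ... | yes fits = fits
        ... | no  ¬fits with z ≤? k + R
        ...   | yes z≤L = contradiction (run-covers {start} {z} {W} (k + R) runW z≤L (≰⇒> ¬fits)) fails-after
        ...   | no  z≰L = contradiction (run-covers {start} {z} {W} (2 * k) runW z≤2k 2k<z+W) fails-before
          where
          2k<z+W : 2 * k < z + W
          2k<z+W = ≤-<-trans (subst (_≤ k + R + W) (sym (double k)) (+-mono-≤ (m≤m+n k R) k≤W))
                             (+-monoˡ-< W (≰⇒> z≰L))

      module Edges (n : ℕ) (s : ℕ → ℕ)
          (boundary⇔run : ∀ j → IsBoundary k n s j ⇔ Run j k)
          (ear⇔run : ∀ j → IsPositiveEar k n s j ⇔ Run (j + k) (suc k)) where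

        boundary-periodic : ∀ j → IsBoundary k n s (j + m) ⇔ IsBoundary k n s j
        boundary-periodic j = begin
          IsBoundary k n s (j + m)  ≈⟨ boundary⇔run (j + m) ⟩
          Run (j + m) k             ≈⟨ run-shift j k ⟩
          Run j k                   ≈⟨ boundary⇔run j ⟨
          IsBoundary k n s j        ∎
          where open ⇔-Reasoning

        ear-periodic : ∀ j → IsPositiveEar k n s (j + m) ⇔ IsPositiveEar k n s j
        ear-periodic j = begin
          IsPositiveEar k n s (j + m)  ≈⟨ ear⇔run (j + m) ⟩
          Run (j + m + k) (suc k)      ≈⟨ ≡⇒⇔ (cong (λ x → Run x (suc k)) (swap j m k)) ⟩
          Run (j + k + m) (suc k)      ≈⟨ run-shift (j + k) (suc k) ⟩
          Run (j + k) (suc k)          ≈⟨ ear⇔run j ⟨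
          IsPositiveEar k n s j        ∎
          where
          open ⇔-Reasoning
          swap : ∀ j m k → j + m + k ≡ j + k + m
          swap = solve-∀

        boundary-offsets : ∀ y → y < m → IsBoundary k n s (start + y) ⇔ (0 ≤ y × y < 0 + suc R)
        boundary-offsets y y<m = begin
          IsBoundary k n s (start + y)  ≈⟨ boundary⇔run (start + y) ⟩
          Run (start + y) k             ≈⟨ window y k ≤-refl (≤-pred y<m) ⟩
          y + k ≤ k + R                 ≈⟨ shift-≤ y R k ⟩
          y ≤ R                         ≈⟨ mk⇔ (λ y≤R → z≤n , s≤s y≤R) (λ (_ , y<1+R) → ≤-pred y<1+R) ⟩
          (0 ≤ y × y < 0 + suc R)       ∎
          where open ⇔-Reasoning

        ear-offsets : ∀ y → y < m → IsPositiveEar k n s (start + y) ⇔ (suc k ≤ y × y < suc k + R)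
        ear-offsets y y<m with suc k ≤? y
        ... | no k≮y = mk⇔ (λ ear → contradiction (to (ear⇔run (start + y)) ear) tooLong)
                           (λ (k<y , _) → contradiction k<y k≮y)
          where
          -- for y ≤ k the window [y + k, y + 2k] would outgrow the maximal run (R ≤ k)
          y+k≤2k : y + k ≤ 2 * k
          y+k≤2k = subst (y + k ≤_) (sym (double k)) (+-monoˡ-≤ k (≤-pred (≰⇒> k≮y)))
          overlong : k + R < y + k + suc k
          overlong = ≤-<-trans (+-monoʳ-≤ k R≤k)
                       (<-≤-trans (+-monoʳ-< k (n<1+n k))
                                  (subst (k + suc k ≤_) (sym (+-assoc y k (suc k))) (m≤n+m (k + suc k) y)))
          tooLong : ¬ Run (start + y + k) (suc k)
          tooLong run′ = <⇒≱ overlong (to (window (y + k) (suc k) (n≤1+n k) y+k≤2k)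
                                          (subst (λ x → Run x (suc k)) (+-assoc start y k) run′))
        ... | yes k<y with m≤n⇒∃[o]m+o≡n k<y
        ...   | h , refl = begin
          IsPositiveEar k n s (start + (suc k + h))    ≈⟨ ear⇔run (start + (suc k + h)) ⟩
          Run (start + (suc k + h) + k) (suc k)        ≈⟨ ≡⇒⇔ (cong (λ x → Run x (suc k)) (wrap start h k)) ⟩
          Run (start + h + m) (suc k)                  ≈⟨ run-shift (start + h) (suc k) ⟩
          Run (start + h) (suc k)                      ≈⟨ window h (suc k) (n≤1+n k) h≤2k ⟩
          h + suc k ≤ k + R                            ≈⟨ ≡⇒⇔ (cong (_≤ k + R) (+-suc h k)) ⟩
          suc h + k ≤ k + R                            ≈⟨ shift-≤ (suc h) R k ⟩
          h < R                                        ≈⟨ mk⇔ (λ h<R → m≤m+n (suc k) h , +-monoʳ-< (suc k) h<R)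
                                                              (λ (_ , lt) → +-cancelˡ-< (suc k) h R lt) ⟩
          (suc k ≤ suc k + h × suc k + h < suc k + R)  ∎
          where
          open ⇔-Reasoning
          wrap : ∀ a h k → a + (suc k + h) + k ≡ a + h + suc (2 * k)
          wrap = solve-∀
          h≤2k : h ≤ 2 * k
          h≤2k = ≤-trans (m≤n+m h (suc k)) (≤-pred y<m)

        numBoundary≡ : numBoundary k n s ≡ suc R
        numBoundary≡ = begin
          numBoundary k n s                      ≡⟨ count-upTo (isBoundary? k n s) m ⟩
          countIn (isBoundary? k n s) 0 m        ≡⟨ countIn-rotate (isBoundary? k n s) m boundary-periodic start ⟩
          countIn (isBoundary? k n s) start m    ≡⟨ countIn-interval (isBoundary? k n s) start m 0 (suc R)
                                                      (s≤s (≤-trans R≤k (m≤m+n k _))) boundary-offsets ⟩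
          suc R                                  ∎
          where open ≡-Reasoning

        numPosEars≡ : numPosEars k n s ≡ R
        numPosEars≡ = begin
          numPosEars k n s                       ≡⟨ count-upTo (isPositiveEar? k n s) m ⟩
          countIn (isPositiveEar? k n s) 0 m     ≡⟨ countIn-rotate (isPositiveEar? k n s) m ear-periodic start ⟩
          countIn (isPositiveEar? k n s) start m ≡⟨ countIn-interval (isPositiveEar? k n s) start m (suc k) R
                                                      (s≤s (subst (k + R ≤_) (sym (double k)) (+-monoʳ-≤ k R≤k)))
                                                      ear-offsets ⟩
          R                                      ∎
          where open ≡-Reasoning

        -- The alternating path starts at the boundary edge of offset R and moves by k
        -- edges at a time, i.e. one vertex backwards modulo m = 2k + 1: boundary edge
        -- at offset h, ear at offset k + 1 + (h - 1), boundary edge at offset h - 1, …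
        j₀ : ℕ
        j₀ = (start + R) % m

        data Step (i : ℕ) : Set where
          boundary-step : ∀ t h → t + h ≡ R → i ≡ t + t → Step i
          ear-step      : ∀ t h → suc (t + h) ≡ R → i ≡ suc (t + t) → Step i

        step : ∀ i → i < suc (R + R) → Step i
        step i i<L with parity i
        ... | t , inj₁ refl = let h , t+h≡R = m≤n⇒∃[o]m+o≡n (half-≤ {t} {R} (≤-pred i<L))
                              in boundary-step t h t+h≡R refl
        ... | t , inj₂ refl = let h , t+h≡R = m≤n⇒∃[o]m+o≡n (half-< {t} {R} (≤-pred i<L))
                              in ear-step t h t+h≡R refl

        offsetOf : ∀ {i} → Step i → ℕ
        offsetOf (boundary-step _ h _ _) = h
        offsetOf (ear-step _ h _ _)      = suc k + h

        offsetOf<m : ∀ {i} (p : Step i) → offsetOf p < m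
        offsetOf<m (boundary-step t h t+h≡R _) =
          s≤s (≤-trans (subst (h ≤_) t+h≡R (m≤n+m h t)) (≤-trans R≤k (m≤m+n k _)))
        offsetOf<m (ear-step t h t+h<R _) = s≤s (subst₂ _≤_ (+-suc k h) (sym (double k)) (+-monoʳ-≤ k h<k))
          where
          h<k : h < k
          h<k = ≤-trans (s≤s (m≤n+m h t)) (subst (_≤ k) (sym t+h<R) R≤k)

        -- 2t steps of k edges move t vertices backwards, since 2k ≡ -1 modulo m
        pathEdge≡ : ∀ {i} (p : Step i) → pathEdge k j₀ i ≡ (start + offsetOf p) % m
        pathEdge≡ {i} p = trans (Cyclic.%-absorbˡ m (start + R) (i * k)) (unfold p)
          where
          unfold : ∀ {i} (p : Step i) → (start + R + i * k) % m ≡ (start + offsetOf p) % m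
          unfold (boundary-step t h refl refl) =
            trans (cong (_% m) (even-steps start t h k)) ([m+kn]%n≡m%n (start + h) t m)
            where
            even-steps : ∀ a t h k → a + (t + h) + (t + t) * k ≡ a + h + t * suc (2 * k)
            even-steps = solve-∀
          unfold (ear-step t h refl refl) =
            trans (cong (_% m) (odd-steps start t h k)) ([m+kn]%n≡m%n (start + (suc k + h)) t m)
            where
            odd-steps : ∀ a t h k → a + suc (t + h) + suc (t + t) * k ≡ a + (suc k + h) + t * suc (2 * k)
            odd-steps = solve-∀

        -- boundary offsets are at most k, ear offsets exceed k
        boundary≢ear : ∀ {t h h′} → t + h ≡ R → h ≢ suc k + h′
        boundary≢ear {t} {h} {h′} t+h≡R eq =
          <⇒≱ (s≤s (m≤m+n k h′)) (subst (_≤ k) eq (≤-trans (subst (h ≤_) t+h≡R (m≤n+m h t)) R≤k))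

        offsetOf-injective : ∀ {i i′} (p : Step i) (p′ : Step i′) → offsetOf p ≡ offsetOf p′ → i ≡ i′
        offsetOf-injective (boundary-step t h t+h≡R refl) (boundary-step t′ h′ t′+h′≡R refl) refl =
          cong (λ u → u + u) (+-cancelʳ-≡ h t t′ (trans t+h≡R (sym t′+h′≡R)))
        offsetOf-injective (ear-step t h t+h<R refl) (ear-step t′ h′ t′+h′<R refl) eq
          with +-cancelˡ-≡ (suc k) h h′ eq
        ... | refl = cong (λ u → suc (u + u)) (+-cancelʳ-≡ h t t′ (suc-injective (trans t+h<R (sym t′+h′<R))))
        offsetOf-injective (boundary-step _ _ t+h≡R _) (ear-step _ _ _ _) eq = contradiction eq (boundary≢ear t+h≡R)
        offsetOf-injective (ear-step _ _ _ _) (boundary-step _ _ t+h≡R _) eq = contradiction (sym eq) (boundary≢ear t+h≡R)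

        boundary-mod : ∀ x → IsBoundary k n s (x % m) ⇔ IsBoundary k n s x
        boundary-mod = Cyclic.residue⇔ m boundary-periodic

        ear-mod : ∀ x → IsPositiveEar k n s (x % m) ⇔ IsPositiveEar k n s x
        ear-mod = Cyclic.residue⇔ m ear-periodic

        alternates : ∀ i → i < suc (R + R) → (i % 2 ≡ 0 → IsBoundary k n s (pathEdge k j₀ i))
                                            × (i % 2 ≡ 1 → IsPositiveEar k n s (pathEdge k j₀ i))
        alternates i i<L with step i i<L
        ... | p@(boundary-step t h t+h≡R refl) =
          (λ _ → subst (IsBoundary k n s) (sym (pathEdge≡ p))
                   (from (boundary-mod (start + h))
                     (from (boundary-offsets h (offsetOf<m p)) (z≤n , s≤s (subst (h ≤_) t+h≡R (m≤n+m h t)))))) ,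
          (λ odd → contradiction (trans (sym (even%2 t)) odd) 0≢1+n)
        ... | p@(ear-step t h t+h<R refl) =
          (λ even → contradiction (trans (sym even) (odd%2 t)) 0≢1+n) ,
          (λ _ → subst (IsPositiveEar k n s) (sym (pathEdge≡ p))
                   (from (ear-mod (start + (suc k + h)))
                     (from (ear-offsets (suc k + h) (offsetOf<m p))
                       (m≤m+n (suc k) h , +-monoʳ-< (suc k) (subst (suc h ≤_) t+h<R (s≤s (m≤n+m h t)))))))

        reached : ∀ y → y < m → IsBoundary k n s (start + y) ⊎ IsPositiveEar k n s (start + y) →
                  ∃[ i ] i < suc (R + R) × Σ (Step i) (λ p → offsetOf p ≡ y)
        reached y y<m (inj₁ boundary) with to (boundary-offsets y y<m) boundary
        ... | _ , y<1+R with m≤n⇒∃[o]m+o≡n (≤-pred y<1+R)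
        ...   | t , y+t≡R = t + t , s≤s (+-mono-≤ t≤R t≤R) ,
                            boundary-step t y (trans (+-comm t y) y+t≡R) refl , refl
          where
          t≤R : t ≤ R
          t≤R = subst (t ≤_) y+t≡R (m≤n+m t y)
        reached y y<m (inj₂ ear) with to (ear-offsets y y<m) ear
        ... | k<y , y<k+1+R with m≤n⇒∃[o]m+o≡n k<y
        ...   | h , refl with m≤n⇒∃[o]m+o≡n (+-cancelˡ-< (suc k) h R y<k+1+R)
        ...     | t , h+t<R = suc (t + t) , s≤s (+-mono-< t<R t<R) ,
                              ear-step t h (trans (cong suc (+-comm t h)) h+t<R) refl , refl
          where
          t<R : t < R
          t<R = subst (suc t ≤_) h+t<R (s≤s (m≤n+m t h))

        path-length : 2 * suc R ∸ 1 ≡ suc (R + R)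
        path-length = length R
          where
          length : ∀ R → R + (suc R + 0) ≡ suc (R + R)
          length = solve-∀

        alternatingPath : AlternatingPath k n s (suc R)
        alternatingPath = j₀ , m%n<n (start + R) m , distinct , alternation , coverage
          where
          distinct : ∀ i i′ → i < 2 * suc R ∸ 1 → i′ < 2 * suc R ∸ 1 →
                     pathEdge k j₀ i ≡ pathEdge k j₀ i′ → i ≡ i′
          distinct i i′ i<L i′<L eq = offsetOf-injective p p′
            (Cyclic.offset-unique m start _ _ (offsetOf<m p) (offsetOf<m p′)
              (trans (sym (pathEdge≡ p)) (trans eq (pathEdge≡ p′))))
            where
            p : Step i
            p = step i (subst (i <_) path-length i<L)
            p′ : Step i′
            p′ = step i′ (subst (i′ <_) path-length i′<L)
          alternation : ∀ i → i < 2 * suc R ∸ 1 → (i % 2 ≡ 0 → IsBoundary k n s (pathEdge k j₀ i))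
                                                 × (i % 2 ≡ 1 → IsPositiveEar k n s (pathEdge k j₀ i))
          alternation i i<L = alternates i (subst (i <_) path-length i<L)
          coverage : ∀ j → j < m → IsBoundary k n s j ⊎ IsPositiveEar k n s j →
                     ∃[ i ] i < 2 * suc R ∸ 1 × j ≡ pathEdge k j₀ i
          coverage j j<m edge =
            let i , i<L , p , offset≡y = reached y (Cyclic.offset<N m start j) (move edge)
            in i , subst (i <_) (sym path-length) i<L ,
               trans (sym reaches) (trans (cong (λ z → (start + z) % m) (sym offset≡y)) (sym (pathEdge≡ p)))
            where
            y : ℕ
            y = Cyclic.offset m start j
            reaches : (start + y) % m ≡ j
            reaches = Cyclic.offset-reaches m start j j<m
            move : IsBoundary k n s j ⊎ IsPositiveEar k n s j →
                   IsBoundary k n s (start + y) ⊎ IsPositiveEar k n s (start + y)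
            move (inj₁ b) = inj₁ (to (boundary-mod (start + y)) (subst (IsBoundary k n s) (sym reaches) b))
            move (inj₂ e) = inj₂ (to (ear-mod (start + y)) (subst (IsPositiveEar k n s) (sym reaches) e))

module Star (k n′ : ℕ) (s : ℕ → ℕ) (star : IsStar k (suc n′) s) where

  m n : ℕ
  m = suc (2 * k)
  n = suc n′

  s-monotone : ∀ i d → i + d < m → s i ≤ s (i + d)
  s-monotone i zero    _  = ≤-reflexive (cong s (sym (+-identityʳ i)))
  s-monotone i (suc d) lt = ≤-trans (s-monotone i d (<-trans (+-monoʳ-< i (n<1+n d)) lt))
    (<⇒≤ (subst (λ z → s (i + d) < s z) (sym (+-suc i d))
                (proj₁ star (i + d) (subst (_< m) (+-suc i d) lt))))

  vertex<n : ∀ i → i < m → s i < n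
  vertex<n i i<m with m≤n⇒∃[o]m+o≡n (≤-pred i<m)
  ... | d , i+d≡2k = ≤-<-trans (s-monotone i d (s≤s (≤-reflexive i+d≡2k)))
                               (subst (λ z → s z < n) (sym i+d≡2k) (proj₂ star))

  -- The lift of the vertex sequence to ℕ, unwinding the n-gon:  S (r + q·m) = s r + q·n.
  S : ℕ → ℕ
  S x = s (x % m) + x / m * n

  S-unfold : ∀ r q → r < m → S (r + q * m) ≡ s r + q * n
  S-unfold r q r<m = cong₂ (λ a b → s a + b * n) remainder quotient
    where
    remainder : (r + q * m) % m ≡ r
    remainder = trans ([m+kn]%n≡m%n r q m) (m<n⇒m%n≡m r<m)
    quotient : (r + q * m) / m ≡ q
    quotient = trans (+-distrib-/-∣ʳ r (divides-refl q)) (cong₂ _+_ (m<n⇒m/n≡0 r<m) (m*n/n≡m q m))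

  S-period : ∀ x → S (x + m) ≡ S x + n
  S-period x = begin
    S (x + m)                ≡⟨ cong (λ z → S (z + m)) (m≡m%n+[m/n]*n x m) ⟩
    S (r + q * m + m)        ≡⟨ cong S (+-assoc r (q * m) m) ⟩
    S (r + (q * m + m))      ≡⟨ cong (λ z → S (r + z)) (+-comm (q * m) m) ⟩
    S (r + suc q * m)        ≡⟨ S-unfold r (suc q) (m%n<n x m) ⟩
    s r + (n + q * n)        ≡⟨ cong (s r +_) (+-comm n (q * n)) ⟩
    s r + (q * n + n)        ≡⟨ +-assoc (s r) (q * n) n ⟨
    S x + n                  ∎
    where
    open ≡-Reasoning
    r = x % m
    q = x / m

  -- S is strictly increasing, also across a turn (s 2k < n ≤ n + s 0)
  S-step : ∀ x → S x < S (suc x)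
  S-step x = subst (λ z → S z < S (suc z)) (sym (m≡m%n+[m/n]*n x m)) (step (x % m) (x / m) (m%n<n x m))
    where
    step : ∀ r q → r < m → S (r + q * m) < S (suc (r + q * m))
    step r q r<m with r <? 2 * k
    ... | yes r<2k = subst₂ _<_ (sym (S-unfold r q r<m)) (sym (S-unfold (suc r) q (s≤s r<2k)))
                            (+-monoˡ-< (q * n) (proj₁ star r (s≤s r<2k)))
    ... | no  r≮2k = subst₂ _<_ (sym (S-unfold r q r<m)) (sym (trans (cong S wrap) (S-unfold 0 (suc q) (s≤s z≤n))))
                            (<-≤-trans (+-monoˡ-< (q * n) (vertex<n r r<m))
                                       (m≤n+m (suc q * n) (s 0)))
      where
      r≡2k : r ≡ 2 * k
      r≡2k = ≤-antisym (≤-pred r<m) (≮⇒≥ r≮2k)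
      wrap : suc (r + q * m) ≡ 0 + suc q * m
      wrap = cong (λ z → suc (z + q * m)) r≡2k

  S-expand : ∀ x d → S x + d ≤ S (x + d)
  S-expand x zero    = ≤-reflexive (trans (+-identityʳ (S x)) (cong S (sym (+-identityʳ x))))
  S-expand x (suc d) = subst₂ _≤_ (sym (+-suc (S x) d)) (cong S (sym (+-suc x d)))
                              (<-≤-trans (s≤s (S-expand x d)) (S-step (x + d)))

  S-mono : ∀ {a b} → a ≤ b → S a ≤ S b
  S-mono {a} a≤b with m≤n⇒∃[o]m+o≡n a≤b
  ... | d , refl = ≤-trans (m≤m+n (S a) d) (S-expand a d)

  S-≤⇔ : ∀ a b → S a ≤ S b ⇔ a ≤ b
  S-≤⇔ a b = mk⇔ (λ le → ≮⇒≥ λ b<a → <⇒≱ (<-≤-trans (S-step b) (S-mono b<a)) le) S-mono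

  ccwDist-lift : ∀ x d → d < m → ccwDist n (vtx k s x) (vtx k s (x + d)) ≡ S (x + d) ∸ S x
  ccwDist-lift x d d<m = mod-difference n (s (x % m)) (s ((x + d) % m)) ((x + d) / m) (x / m) (S (x + d) ∸ S x)
    (vertex<n (x % m) (m%n<n x m)) within (sym (m+[n∸m]≡n (S-mono (m≤m+n x d))))
    where
    within : S (x + d) ∸ S x < n
    within = +-cancelˡ-< (S x) _ n (subst₂ _<_ (sym (m+[n∸m]≡n (S-mono (m≤m+n x d)))) (S-period x)
               (<-≤-trans (S-step (x + d)) (S-mono (subst (_≤ x + m) (+-suc x d) (+-monoʳ-≤ x d<m)))))

  Unit : ℕ → Set
  Unit x = S (suc x) ≡ suc (S x)

  unit? : Decidable Unit
  unit? x = S (suc x) ≟ suc (S x)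

  open Runs unit? public

  unit-periodic : ∀ x → Unit (x + m) ⇔ Unit x
  unit-periodic x = mk⇔ (λ u → +-cancelʳ-≡ n _ _ (trans (sym (S-period (suc x))) (trans u (cong suc (S-period x)))))
                        (λ u → trans (S-period (suc x)) (trans (cong (_+ n) u) (cong suc (sym (S-period x)))))

  tight⇔run : ∀ x L → S (x + L) ∸ S x ≡ L ⇔ Run x L
  tight⇔run x L = ⇔.trans (mk⇔ (λ eq → trans (cong (S x +_) (sym eq)) (m+[n∸m]≡n (S-mono (m≤m+n x L))))
                                (λ eq → trans (cong (_∸ S x) (sym eq)) (m+n∸m≡n (S x) L)))
                          (mk⇔ (tight⇒run L) (run⇒tight L))
    where
    run⇒tight : ∀ L → Run x L → S x + L ≡ S (x + L)
    run⇒tight zero    _   = trans (+-identityʳ (S x)) (cong S (sym (+-identityʳ x)))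
    run⇒tight (suc L) run = begin
      S x + suc L        ≡⟨ +-suc (S x) L ⟩
      suc (S x + L)      ≡⟨ cong suc (run⇒tight L (λ d d<L → run d (m<n⇒m<1+n d<L))) ⟩
      suc (S (x + L))    ≡⟨ run L ≤-refl ⟨
      S (suc (x + L))    ≡⟨ cong S (+-suc x L) ⟨
      S (x + suc L)      ∎
      where open ≡-Reasoning
    tight⇒run : ∀ L → S x + L ≡ S (x + L) → Run x L
    tight⇒run zero    _     = λ _ ()
    tight⇒run (suc L) tight = run-snoc (tight⇒run L tightL) unit
      where
      last : S (suc (x + L)) ≡ suc (S x + L)
      last = trans (cong S (sym (+-suc x L))) (trans (sym tight) (+-suc (S x) L))
      tightL : S x + L ≡ S (x + L)
      tightL = ≤-antisym (S-expand x L) (≤-pred (subst (S (x + L) <_) last (S-step (x + L))))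
      unit : Unit (x + L)
      unit = trans last (cong suc tightL)

  noFullRun : m < n → ∀ x → ¬ Run x m
  noFullRun m<n x run = <-irrefl (+-cancelˡ-≡ (S x) m n (trans full (S-period x))) m<n
    where
    full : S x + m ≡ S (x + m)
    full = trans (cong (S x +_) (sym (from (tight⇔run x m) run))) (m+[n∸m]≡n (S-mono (m≤m+n x m)))

  vtx-period : ∀ x → vtx k s (x + m) ≡ vtx k s x
  vtx-period x = cong s ([m+n]%n≡m%n x m)

  span≥ : ∀ x d → d ≤ S (x + d) ∸ S x
  span≥ x d = subst (_≤ S (x + d) ∸ S x) (m+n∸m≡n (S x) d) (∸-monoˡ-≤ (S x) (S-expand x d))

  on-arc⇔ : ∀ x d e → d < m → e < m →
            between n (vtx k s x) (vtx k s (x + e)) (vtx k s (x + d)) ⇔ e ≤ d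
  on-arc⇔ x d e d<m e<m = begin
    between n (vtx k s x) (vtx k s (x + e)) (vtx k s (x + d))
      ≈⟨ ≡⇒⇔ (cong₂ _≤_ (ccwDist-lift x e e<m) (ccwDist-lift x d d<m)) ⟩
    S (x + e) ∸ S x ≤ S (x + d) ∸ S x
      ≈⟨ ∸-≤⇔ (S-mono (m≤m+n x e)) (S-mono (m≤m+n x d)) ⟩
    S (x + e) ≤ S (x + d)
      ≈⟨ S-≤⇔ (x + e) (x + d) ⟩
    x + e ≤ x + d
      ≈⟨ mk⇔ (+-cancelˡ-≤ x e d) (+-monoʳ-≤ x) ⟩
    e ≤ d ∎
    where open ⇔-Reasoning

  countBetween-lift : ∀ x d → d < m → countBetween k n s (vtx k s x) (vtx k s (x + d)) ≡ suc d
  countBetween-lift x d d<m = begin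
    countBetween k n s u v   ≡⟨ count-upTo onArc? m ⟩
    countIn onArc? 0 m       ≡⟨ countIn-cong onArc? passed? 0 m (λ i i<m →
                                  ≡⇒⇔ (cong (λ z → between n u (s z) v) (sym (m<n⇒m%n≡m i<m)))) ⟩
    countIn passed? 0 m      ≡⟨ countIn-rotate passed? m (λ i →
                                  ≡⇒⇔ (cong (λ w → between n u w v) (vtx-period i))) x ⟩
    countIn passed? x m      ≡⟨ countIn-interval passed? x m 0 (suc d) d<m (λ e e<m →
                                  ⇔.trans (on-arc⇔ x d e d<m e<m) (mk⇔ (λ e≤d → z≤n , s≤s e≤d) (≤-pred ∘ proj₂))) ⟩
    suc d                    ∎
    where
    open ≡-Reasoning
    u v : ℕ
    u = vtx k s x
    v = vtx k s (x + d)
    onArc? : Decidable (λ i → between n u (s i) v)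
    onArc? i = between? n u (s i) v
    passed? : Decidable (λ i → between n u (vtx k s i) v)
    passed? i = between? n u (vtx k s i) v

  module Proper (1≤k : 1 ≤ k) where

    k<m : k < m
    k<m = s≤s (m≤m+n k _)

    1+k<m : suc k < m
    1+k<m = s≤s (subst (_≤ 2 * k) (+-comm k 1) (subst (k + 1 ≤_) (sym (double k)) (+-monoʳ-≤ k 1≤k)))

    return : ∀ j → vtx k s (j + k + suc k) ≡ eA k s j
    return j = trans (cong (vtx k s) (around j k)) (vtx-period j)
      where
      around : ∀ j k → j + k + suc k ≡ j + suc (2 * k)
      around = solve-∀

    forward-dist : ∀ j → ccwDist n (eA k s j) (eB k s j) ≡ S (j + k) ∸ S j
    forward-dist j = ccwDist-lift j k k<m

    backward-dist : ∀ j → ccwDist n (eB k s j) (eA k s j) ≡ S (j + k + suc k) ∸ S (j + k)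
    backward-dist j = trans (cong (ccwDist n (eB k s j)) (sym (return j))) (ccwDist-lift (j + k) (suc k) 1+k<m)

    forward-count : ∀ j → countBetween k n s (eA k s j) (eB k s j) ≡ suc k
    forward-count j = countBetween-lift j k k<m

    backward-count : ∀ j → countBetween k n s (eB k s j) (eA k s j) ≡ suc (suc k)
    backward-count j = trans (cong (countBetween k n s (eB k s j)) (sym (return j)))
                             (countBetween-lift (j + k) (suc k) 1+k<m)

    boundary⇔run : ∀ j → IsBoundary k n s j ⇔ Run j k
    boundary⇔run j = begin
      IsBoundary k n s j
        ≈⟨ ≡⇒⇔ (cong (_≡ k) (cong₂ _⊓_ (forward-dist j) (backward-dist j))) ⟩
      (S (j + k) ∸ S j) ⊓ (S (j + k + suc k) ∸ S (j + k)) ≡ k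
        ≈⟨ ⊓≡⇔ (span≥ j k) (span≥ (j + k) (suc k)) ⟩
      S (j + k) ∸ S j ≡ k
        ≈⟨ tight⇔run j k ⟩
      Run j k ∎
      where open ⇔-Reasoning

    -- an edge is a positive ear iff the k + 1 gaps leading back to it are units;
    -- the star always lies on the positive side of s_j → s_{j+k}, never of s_{j+k} → s_j
    ear⇔run : ∀ j → IsPositiveEar k n s j ⇔ Run (j + k) (suc k)
    ear⇔run j = mk⇔ ear⇒run λ run →
      inj₁ (subst₂ _<_ (sym (forward-count j)) (sym (backward-count j)) (n<1+n (suc k)) ,
            trans (backward-dist j) (from (tight⇔run (j + k) (suc k)) run))
      where
      ear⇒run : IsPositiveEar k n s j → Run (j + k) (suc k)
      ear⇒run (inj₁ (_ , dist)) = to (tight⇔run (j + k) (suc k)) (trans (sym (backward-dist j)) dist)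
      ear⇒run (inj₂ (positive , _)) =
        contradiction (subst₂ _<_ (backward-count j) (forward-count j) positive) (<-asym (n<1+n (suc k)))

ccwDist-self : ∀ n′ u → ccwDist (suc n′) u u ≡ 0
ccwDist-self n′ u = trans (cong (_% suc n′) (m+n∸m≡n u (suc n′))) (n%n≡0 (suc n′))

loop-dists : ∀ n′ s j →
  ccwDist (suc n′) (eA 0 s j) (eB 0 s j) ≡ 0 × ccwDist (suc n′) (eB 0 s j) (eA 0 s j) ≡ 0
loop-dists n′ s j = subst (λ b → ccwDist (suc n′) (eA 0 s j) b ≡ 0 × ccwDist (suc n′) b (eA 0 s j) ≡ 0)
                          (cong (λ z → s (z % 1)) (sym (+-identityʳ j)))
                          (ccwDist-self n′ (eA 0 s j) , ccwDist-self n′ (eA 0 s j))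

-- For every k, boundary edges and ears are runs of unit gaps; for k = 0 every edge
-- is a boundary edge and none is an ear, matching the trivial runs.
edges⇔runs : ∀ k n′ s (star : IsStar k (suc n′) s) → let open Star k n′ s star in m < n →
  (∀ j → IsBoundary k n s j ⇔ Run j k) × (∀ j → IsPositiveEar k n s j ⇔ Run (j + k) (suc k))
edges⇔runs (suc k) n′ s star _   = boundary⇔run , ear⇔run
  where open Star.Proper (suc k) n′ s star (s≤s z≤n)
edges⇔runs zero    n′ s star m<n =
  (λ j → mk⇔ (λ _ _ ()) (λ _ → cong₂ _⊓_ (proj₁ (loop-dists n′ s j)) (proj₂ (loop-dists n′ s j)))) ,
  (λ j → mk⇔ (λ ear → contradiction ear (no-ear j)) (λ run → contradiction run (noFullRun m<n (j + 0))))
  where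
  open Star zero n′ s star
  no-ear : ∀ j → ¬ IsPositiveEar 0 n s j
  no-ear j (inj₁ (_ , dist)) = 0≢1+n (trans (sym (proj₂ (loop-dists n′ s j))) dist)
  no-ear j (inj₂ (_ , dist)) = 0≢1+n (trans (sym (proj₁ (loop-dists n′ s j))) dist)

lemma6p1 : (k n : ℕ) → 2 * k + 3 ≤ n → (s : ℕ → ℕ) → IsStar k n s →
    IsExternal k n s →
    numPosEars k n s ≡ numBoundary k n s ∸ 1 × AlternatingPath k n s (numBoundary k n s)
lemma6p1 k zero     large _ _    _                  = contradiction (≤-trans (m≤n+m 3 (2 * k)) large) λ ()
lemma6p1 k (suc n′) large s star (j , _ , boundary) =
  trans numPosEars≡ (cong (_∸ 1) (sym numBoundary≡)) ,
  subst (AlternatingPath k n s) (sym numBoundary≡) alternatingPath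
  where
  open Star k n′ s star
  m<n : m < n
  m<n = ≤-trans (n≤1+n _) (subst (_≤ n) (+-comm (2 * k) 3) large)
  boundary⇔run : ∀ j → IsBoundary k n s j ⇔ Run j k
  boundary⇔run = proj₁ (edges⇔runs k n′ s star m<n)
  ear⇔run : ∀ j → IsPositiveEar k n s j ⇔ Run (j + k) (suc k)
  ear⇔run = proj₂ (edges⇔runs k n′ s star m<n)
  open Periodic k unit-periodic (noFullRun m<n)
  open Around (maxRun j (to (boundary⇔run j) boundary))
  open Edges n s boundary⇔run ear⇔run
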